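{- Let $n\ge1$ and let $m=(m_0,\dots,m_n)$ be a sequence of non-negative integers. Define \[ X_m := R_{m_0,m_0}R_{m_0,m_1}L_{m_1,m_2}L_{m_2,m_3}\cdots L_{m_{n-1},m_n}. \] Then for all $1\le i\le m_0+1$ and $1\le j\le m_n+1$, the $(i,j)$-entry of $X_m$ equals the number of mixed dimer covers of $\mathcal{G}^z_n$ with labeling $(m_0+1-i,m_1,\dots,m_{n-1},m_n+1-j)$. In particular, the $(1,1)$-entry equals the number of mixed dimer covers of $\mathcal{G}^z_n$ with labeling $m$.
   Context: Mixed dimer covers: for a finite graph $\mathcal{G}=(V,E)$ and $\mathbf{n}\colon V\to\mathbb{N}$, a mixed dimer cover is a function $\omega\colon E\to\mathbb{N}$ with $\sum_{e\ni v}\omega(e)=\mathbf{n}(v)$ for each vertex $v$. Zigzag snake graph $\mathcal{G}^z_n$: union of unit squares $T_1,\dots,T_n$ with $T_{2j+1}$ having lower-left corner $(j,j)$ and $T_{2j}$ having lower-left corner $(j-1,j)$; vertices are the lattice points on the tiles, edges the unit sides. Its vertices are partitioned into pairs $P_0,\dots,P_n$: for $1\le k\le n$, if $k=2j+1$ then $P_{k-1}=\{(j,j),(j+1,j)\}$, if $k=2j$ then $P_{k-1}=\{(j-1,j),(j-1,j+1)\}$; $P_n$ is the remaining two vertices. The labeling $(x_0,\dots,x_n)$ gives both vertices of $P_i$ the value $x_i$ (a labeling with a negative entry admits no covers). $R_{a,b}$ is the $(a+1)\times(b+1)$ matrix with $(i,j)$-entry $1$ if $i+j\le b+2$ and $0$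 otherwise; $W$ is the $(a+1)\times(a+1)$ anti-diagonal matrix with $W_{ij}=1$ if $i+j=a+2$ and $0$ otherwise; $L_{a,b}:=WR_{a,b}$ (the rows of $R_{a,b}$ in reverse order). -}

module Defs where

open import Data.Bool using (Bool; true; false; if_then_else_; _∨_)
open import Data.Nat using (ℕ; zero; suc; _+_; _*_; _∸_; _≤ᵇ_; _≡ᵇ_; _/_; _%_)
import Data.Nat as ℕ
open import Data.Fin using (Fin; toℕ; fromℕ)
import Data.Fin as F
open import Data.Product using (_×_; _,_; Σ)
open import Data.Product.Properties using (≡-dec)
open import Data.List using (List; []; _∷_; length; concatMap; map; upTo; deduplicate; zipWith)
open import Data.Bool.ListAction using (any)
open import Data.Nat.ListAction using (sum)
open import Data.List.Relation.Unary.All using (All)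
open import Data.Vec using (Vec; []; _∷_; toList; _[_]≔_)
open import Relation.Nullary.Decidable using (⌊_⌋; Dec)
open import Relation.Binary.PropositionalEquality using (_≡_)

Mat : ℕ → ℕ → Set
Mat r c = Fin r → Fin c → ℕ

∑ : ∀ {n} → (Fin n → ℕ) → ℕ
∑ {zero}  f = 0
∑ {suc n} f = f F.zero + ∑ (λ k → f (F.suc k))

infixl 7 _⊗_
_⊗_ : ∀ {r s t} → Mat r s → Mat s t → Mat r t
(A ⊗ B) i j = ∑ (λ k → A i k * B k j)

-- R_{a,b}: (a+1)×(b+1), entry 1 iff i+j ≤ b+2 (1-indexed), i.e. i'+j' ≤ b (0-indexed)
R : (a b : ℕ) → Mat (suc a) (suc b)
R a b i j = if toℕ i + toℕ j ≤ᵇ b then 1 else 0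

-- W: (a+1)×(a+1) anti-diagonal, entry 1 iff i+j = a+2 (1-indexed), i.e. i'+j' = a
W : (a : ℕ) → Mat (suc a) (suc a)
W a i j = if toℕ i + toℕ j ≡ᵇ a then 1 else 0

L : (a b : ℕ) → Mat (suc a) (suc b)
L a b = W a ⊗ R a b

headV : ∀ {k} → Vec ℕ (suc k) → ℕ
headV (x ∷ _) = x

lastV : ∀ {k} → Vec ℕ (suc k) → ℕ
lastV (x ∷ [])     = x
lastV (x ∷ y ∷ ys) = lastV (y ∷ ys)

Lchain : ∀ {k} (a : ℕ) (bs : Vec ℕ (suc k)) → Mat (suc a) (suc (lastV bs))
Lchain a (b ∷ [])     = L a b
Lchain a (b ∷ c ∷ cs) = L a b ⊗ Lchain b (c ∷ cs)

X : ∀ {k} (m : Vec ℕ (suc (suc k))) → Mat (suc (headV m)) (suc (lastV m))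
X (m0 ∷ m1 ∷ [])      = R m0 m0 ⊗ R m0 m1
X (m0 ∷ m1 ∷ m2 ∷ ms) = (R m0 m0 ⊗ R m0 m1) ⊗ Lchain m1 (m2 ∷ ms)

Point : Set
Point = ℕ × ℕ

-- an edge is a unit segment, stored as (endpoint, endpoint) with the
-- lexicographically smaller endpoint first
Edge : Set
Edge = Point × Point

_≟P_ : (p q : Point) → Dec (p ≡ q)
_≟P_ = ≡-dec ℕ._≟_ ℕ._≟_

_≟E_ : (e f : Edge) → Dec (e ≡ f)
_≟E_ = ≡-dec _≟P_ _≟P_

-- lower-left corner of T_k (k ≥ 1): k = 2j+1 ↦ (j,j); k = 2j ↦ (j-1,j)
tileLL : ℕ → Point
tileLL k = if k % 2 ≡ᵇ 1 then (k / 2 , k / 2) else (k / 2 ∸ 1 , k / 2)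

tiles : ℕ → List Point
tiles n = map (λ i → tileLL (suc i)) (upTo n)

corners : Point → List Point
corners (a , b) = (a , b) ∷ (suc a , b) ∷ (a , suc b) ∷ (suc a , suc b) ∷ []

sides : Point → List Edge
sides (a , b) = ((a , b) , (suc a , b))
              ∷ ((a , suc b) , (suc a , suc b))
              ∷ ((a , b) , (a , suc b))
              ∷ ((suc a , b) , (suc a , suc b))
              ∷ []

vertices : ℕ → List Point
vertices n = deduplicate _≟P_ (concatMap corners (tiles n))

edges : ℕ → List Edge
edges n = deduplicate _≟E_ (concatMap sides (tiles n))

-- the pair P_{k-1}, for 1 ≤ k ≤ n
pairOf : ℕ → List Point
pairOf k = if k % 2 ≡ᵇ 1
           then (k / 2 , k / 2) ∷ (suc (k / 2) , k / 2) ∷ []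
           else (k / 2 ∸ 1 , k / 2) ∷ (k / 2 ∸ 1 , suc (k / 2)) ∷ []

_∈ᵇ_ : Point → List Point → Bool
v ∈ᵇ ps = any (λ p → ⌊ p ≟P v ⌋) ps

-- value of the labeling (x_0,...,x_n) at a vertex v: x_i if v ∈ P_i
-- (i < n, with P_i = pairOf (i+1)); otherwise v is in P_n and gets x_n.
labelAt : ∀ {n} → Vec ℕ (suc n) → ℕ → Point → ℕ
labelAt {zero}  (x ∷ [])       k v = x
labelAt {suc n} (x ∷ y ∷ xs)   k v =
  if v ∈ᵇ pairOf k then x else labelAt (y ∷ xs) (suc k) v

label : ∀ {n} → Vec ℕ (suc n) → Point → ℕ
label x v = labelAt x 1 v

incident : Point → Edge → Bool
incident v (p , q) = ⌊ p ≟P v ⌋ ∨ ⌊ q ≟P v ⌋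

incSum : Point → (es : List Edge) → Vec ℕ (length es) → ℕ
incSum v es ω = sum (zipWith (λ e w → if incident v e then w else 0) es (toList ω))

IsCover : ∀ n → Vec ℕ (suc n) → Vec ℕ (length (edges n)) → Set
IsCover n x ω = All (λ v → incSum v (edges n) ω ≡ label x v) (vertices n)

Covers : ∀ n → Vec ℕ (suc n) → Set
Covers n x = Σ (Vec ℕ (length (edges n))) (IsCover n x)

{-# OPTIONS --safe #-}
module Submission where

-- Both sides obey the same recursion. Multiplying out, the (i , j)-entry of X_m counts the weakly
-- increasing sequences bounded termwise by the modified labeling; deleting the last term of such a
-- sequence gives a recursion in n. On the graph side, G_{N+1} is G_N with a tile glued along the side
-- (a , b) of T_N. In a cover the weight g of the new side opposite (a , b) forces the weights of the two
-- other new sides and leaves the demand g at a and at b, so the covers of G_{N+1} correspond to a choice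
-- of g ≤ x_N , x_{N+1} together with a cover of G_N in which x_N is replaced by g.

open import Defs
open import Data.Nat using (ℕ; suc; _∸_)
open import Data.Fin using (Fin; toℕ; fromℕ; zero)
open import Data.Vec using (Vec; _[_]≔_)
open import Data.Product using (_×_)
open import Function.Bundles using (_↔_)

open import Data.Bool using (Bool; true; false; if_then_else_; T; _∨_)
open import Data.Bool.Properties using (T-irrelevant; ∨-zeroʳ)
import Data.Fin as Fin
open import Data.Fin.Properties using (toℕ<n; +↔⊎)
open import Data.List using (List; []; _∷_; _++_; length; map; concatMap; upTo; deduplicate)
open import Data.List.Properties using (map-++; concatMap-++; ++-identityʳ; upTo-∷ʳ)
open import Data.List.Membership.Propositional using (_∉_)
open import Data.List.Membership.Propositional.Properties using (∈-deduplicate⁺; ∈-deduplicate⁻; ∈-++⁻)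
open import Data.List.Membership.Propositional.Properties.WithK using (unique∧set⇒bag)
open import Data.List.Relation.Binary.BagAndSetEquality using (∼bag⇒↭)
open import Data.List.Relation.Binary.Permutation.Propositional as ↭ using (_↭_; ↭-sym)
open import Data.List.Relation.Binary.Permutation.Propositional.Properties
  using (All-resp-↭; ↭-sym-involutive; map⁺) renaming (shift to ↭-shift)
open import Data.List.Relation.Binary.Subset.Propositional using (_⊆_)
import Data.List.Relation.Binary.Subset.Propositional.Properties as ⊆
open import Data.List.Relation.Unary.All as All using (All; []; _∷_)
import Data.List.Relation.Unary.All.Properties as All
open import Data.List.Relation.Unary.AllPairs using ([]; _∷_)
open import Data.List.Relation.Unary.Any using (here; there)
open import Data.List.Relation.Unary.Unique.Propositional using (Unique)
import Data.List.Relation.Unary.Unique.Propositional.Properties as Unique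
open import Data.List.Relation.Unary.Unique.DecPropositional.Properties using (deduplicate-!)
open import Data.Nat using (zero; _+_; _*_; _⊓_; _≤_; _<_; z≤n; s≤s; z<s; s<s; s≤s⁻¹; _≤ᵇ_; _≡ᵇ_; _≤?_; _≟_; _%_; _/_)
open import Data.Nat.DivMod using (m/n≡1+[m∸n]/n)
open import Data.Nat.Properties
open import Algebra.Properties.CommutativeSemigroup +-commutativeSemigroup using (interchange; x∙yz≈y∙xz)
open import Data.Product using (Σ; _,_; proj₁; proj₂)
open import Data.Product.Function.Dependent.Propositional using (Σ-↔)
open import Data.Product.Function.NonDependent.Propositional using (_×-↔_)
open import Data.Product.Properties using (Σ-≡,≡→≡)
open import Data.Sum using (_⊎_; inj₁; inj₂; [_,_]′)
open import Data.Sum.Function.Propositional using (_⊎-↔_)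
open import Data.Unit using (tt)
open import Data.Vec using ([]; _∷_)
open import Function using (_∘_; id; case_of_; _⇔_; mk⇔; mk↔ₛ′; Equivalence)
open import Function.Properties.Inverse using (↔-refl; ↔-trans)
import Function.Related.Propositional as Related
open import Relation.Binary.Definitions using (DecidableEquality)
open import Relation.Binary.PropositionalEquality
open import Relation.Nullary using (Dec; yes; no; ¬_; Irrelevant)
open import Relation.Nullary.Decidable using (⌊_⌋; isYes≗does; dec-true; dec-false; does-⇔)

infixr 8 [_]·_

[_]·_ : Bool → ℕ → ℕ
[ c ]· x = if c then x else 0

[]·1-* : ∀ c x → [ c ]· 1 * x ≡ [ c ]· x
[]·1-* true  x = +-identityʳ x
[]·1-* false x = refl

[]·-comm : ∀ c d x → [ c ]· [ d ]· x ≡ [ d ]· [ c ]· x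
[]·-comm true  d     x = refl
[]·-comm false true  x = refl
[]·-comm false false x = refl

≤ᵇ-true : ∀ {m n} → m ≤ n → (m ≤ᵇ n) ≡ true
≤ᵇ-true {m} {n} = dec-true (m ≤? n)

≤ᵇ-false : ∀ {m n} → n < m → (m ≤ᵇ n) ≡ false
≤ᵇ-false {m} {n} n<m = dec-false (m ≤? n) (<⇒≱ n<m)

≤ᵇ-suc : ∀ m n → (suc m ≤ᵇ suc n) ≡ (m ≤ᵇ n)
≤ᵇ-suc m n = does-⇔ (mk⇔ s≤s⁻¹ s≤s) (suc m ≤? suc n) (m ≤? n)

+-≤ᵇ : ∀ x {y c} → y ≤ c → (x + y ≤ᵇ c) ≡ (x ≤ᵇ c ∸ y)
+-≤ᵇ x y≤c = does-⇔ (mk⇔ (m+n≤o⇒m≤o∸n x) (m≤o∸n⇒m+n≤o x y≤c)) (_ ≤? _) (_ ≤? _)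

+-≤ᵇ′ : ∀ {x} y {c} → x ≤ c → (x + y ≤ᵇ c) ≡ (y ≤ᵇ c ∸ x)
+-≤ᵇ′ {x} y {c} x≤c = trans (cong (_≤ᵇ c) (+-comm x y)) (+-≤ᵇ y x≤c)

≡ᵇ-refl : ∀ n → (n ≡ᵇ n) ≡ true
≡ᵇ-refl n = dec-true (n ≟ n) refl

≡ᵇ-false : ∀ {m n} → m ≢ n → (m ≡ᵇ n) ≡ false
≡ᵇ-false {m} {n} = dec-false (m ≟ n)

+-≡ᵇ : ∀ x {y c} → x ≤ c → (x + y ≡ᵇ c) ≡ (y ≡ᵇ c ∸ x)
+-≡ᵇ zero    _         = refl
+-≡ᵇ (suc x) (s≤s x≤c) = +-≡ᵇ x x≤c

⌊⌋-true : ∀ {A : Set} (d : Dec A) → A → ⌊ d ⌋ ≡ true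
⌊⌋-true d a = trans (isYes≗does d) (dec-true d a)

⌊⌋-false : ∀ {A : Set} (d : Dec A) → ¬ A → ⌊ d ⌋ ≡ false
⌊⌋-false d ¬a = trans (isYes≗does d) (dec-false d ¬a)

∑< : ℕ → (ℕ → ℕ) → ℕ
∑< zero    h = 0
∑< (suc n) h = h 0 + ∑< n (h ∘ suc)

∑<-cong : ∀ n {h h′ : ℕ → ℕ} → (∀ {k} → k < n → h k ≡ h′ k) → ∑< n h ≡ ∑< n h′
∑<-cong zero    eq = refl
∑<-cong (suc n) eq = cong₂ _+_ (eq z<s) (∑<-cong n (eq ∘ s<s))

∑<-ext : ∀ n {h h′ : ℕ → ℕ} → (∀ k → h k ≡ h′ k) → ∑< n h ≡ ∑< n h′
∑<-ext n eq = ∑<-cong n (λ {k} _ → eq k)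

∑<-zero : ∀ n {h : ℕ → ℕ} → (∀ k → h k ≡ 0) → ∑< n h ≡ 0
∑<-zero zero    eq = refl
∑<-zero (suc n) eq = cong₂ _+_ (eq 0) (∑<-zero n (eq ∘ suc))

∑<-+ : ∀ n (h g : ℕ → ℕ) → ∑< n (λ k → h k + g k) ≡ ∑< n h + ∑< n g
∑<-+ zero    h g = refl
∑<-+ (suc n) h g = trans (cong (h 0 + g 0 +_) (∑<-+ n (h ∘ suc) (g ∘ suc)))
                         (interchange (h 0) (g 0) _ _)

∑<-comm : ∀ n m (H : ℕ → ℕ → ℕ) → ∑< n (λ a → ∑< m (H a)) ≡ ∑< m (λ b → ∑< n (λ a → H a b))
∑<-comm zero    m H = sym (∑<-zero m (λ _ → refl))
∑<-comm (suc n) m H = trans (cong (∑< m (H 0) +_) (∑<-comm n m (H ∘ suc)))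
                            (sym (∑<-+ m (H 0) _))

∑<-*ʳ : ∀ n (h : ℕ → ℕ) c → ∑< n h * c ≡ ∑< n (λ k → h k * c)
∑<-*ʳ zero    h c = refl
∑<-*ʳ (suc n) h c = trans (*-distribʳ-+ c (h 0) _) (cong (h 0 * c +_) (∑<-*ʳ n (h ∘ suc) c))

∑<-snoc : ∀ n (h : ℕ → ℕ) → ∑< (suc n) h ≡ ∑< n h + h n
∑<-snoc zero    h = +-identityʳ (h 0)
∑<-snoc (suc n) h = trans (cong (h 0 +_) (∑<-snoc n (h ∘ suc))) (sym (+-assoc (h 0) _ _))

∑<-reverse : ∀ b (h : ℕ → ℕ) → ∑< (suc b) h ≡ ∑< (suc b) (λ k → h (b ∸ k))
∑<-reverse zero    h = refl
∑<-reverse (suc b) h = begin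
  h 0 + ∑< (suc b) (h ∘ suc)                    ≡⟨ cong (h 0 +_) (∑<-reverse b (h ∘ suc)) ⟩
  h 0 + ∑< (suc b) (λ k → h (suc (b ∸ k)))      ≡⟨ +-comm (h 0) _ ⟩
  ∑< (suc b) (λ k → h (suc (b ∸ k))) + h 0      ≡⟨ cong₂ _+_ (∑<-cong (suc b) (cong h ∘ sym ∘ +-∸-assoc 1 ∘ s≤s⁻¹))
                                                              (cong h (sym (n∸n≡0 b))) ⟩
  ∑< (suc b) (λ k → h (suc b ∸ k)) + h (b ∸ b)  ≡⟨ ∑<-snoc (suc b) (λ k → h (suc b ∸ k)) ⟨
  ∑< (suc (suc b)) (λ k → h (suc b ∸ k))        ∎
  where open ≡-Reasoning

∑<-select : ∀ n d (h : ℕ → ℕ) → d < n → ∑< n (λ l → [ l ≡ᵇ d ]· h l) ≡ h d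
∑<-select (suc n) zero    h _         = trans (cong (h 0 +_) (∑<-zero n (λ _ → refl))) (+-identityʳ (h 0))
∑<-select (suc n) (suc d) h (s<s d<n) = ∑<-select n d (h ∘ suc) d<n

∑<-truncate : ∀ n d (h : ℕ → ℕ) → d < n → ∑< n (λ l → [ l ≤ᵇ d ]· h l) ≡ ∑< (suc d) h
∑<-truncate (suc n) zero    h _         = cong (h 0 +_) (∑<-zero n (λ _ → refl))
∑<-truncate (suc n) (suc d) h (s<s d<n) = cong (h 0 +_) (trans
  (∑<-ext n (λ l → cong (λ c → [ c ]· h (suc l)) (≤ᵇ-suc l d)))
  (∑<-truncate n d (h ∘ suc) d<n))

[]·-∑< : ∀ c n (h : ℕ → ℕ) → [ c ]· ∑< n h ≡ ∑< n (λ k → [ c ]· h k)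
[]·-∑< true  n h = refl
[]·-∑< false n h = sym (∑<-zero n (λ _ → refl))

∑<-comm-guarded : ∀ n m (c d : ℕ → Bool) (H : ℕ → ℕ → ℕ) →
  ∑< n (λ a → [ c a ]· ∑< m (λ b → [ d b ]· H a b)) ≡ ∑< m (λ b → [ d b ]· ∑< n (λ a → [ c a ]· H a b))
∑<-comm-guarded n m c d H = begin
  ∑< n (λ a → [ c a ]· ∑< m (λ b → [ d b ]· H a b))    ≡⟨ ∑<-ext n (λ a → []·-∑< (c a) m _) ⟩
  ∑< n (λ a → ∑< m (λ b → [ c a ]· [ d b ]· H a b))    ≡⟨ ∑<-comm n m _ ⟩
  ∑< m (λ b → ∑< n (λ a → [ c a ]· [ d b ]· H a b))    ≡⟨ ∑<-ext m (λ b → ∑<-ext n (λ a → []·-comm (c a) (d b) _)) ⟩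
  ∑< m (λ b → ∑< n (λ a → [ d b ]· [ c a ]· H a b))    ≡⟨ ∑<-ext m (λ b → []·-∑< (d b) n _) ⟨
  ∑< m (λ b → [ d b ]· ∑< n (λ a → [ c a ]· H a b))    ∎
  where open ≡-Reasoning

Σ-irrelevant-↔ : ∀ {A B : Set} {P : A → Set} {Q : B → Set} →
  (∀ {a} → Irrelevant (P a)) → (∀ {b} → Irrelevant (Q b)) →
  (f : A → B) (g : B → A) → (∀ {a} → P a → Q (f a)) → (∀ {b} → Q b → P (g b)) →
  (∀ {a} → P a → g (f a) ≡ a) → (∀ {b} → Q b → f (g b) ≡ b) → Σ A P ↔ Σ B Q
Σ-irrelevant-↔ P-irr Q-irr f g fP gQ gf fg = mk↔ₛ′
  (λ (a , p) → f a , fP p) (λ (b , q) → g b , gQ q)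
  (λ (b , q) → Σ-≡,≡→≡ (fg q , Q-irr _ _)) (λ (a , p) → Σ-≡,≡→≡ (gf p , P-irr _ _))

Σ-×-assoc-↔ : ∀ {A V : Set} {B : A → Set} {C : A → V → Set} →
  Σ (A × V) (λ (a , v) → B a × C a v) ↔ Σ A (λ a → B a × Σ V (C a))
Σ-×-assoc-↔ = mk↔ₛ′ (λ ((a , v) , b , c) → a , b , v , c) (λ (a , b , v , c) → (a , v) , b , c)
                    (λ _ → refl) (λ _ → refl)

Fin-∑< : ∀ n (h : ℕ → ℕ) → Fin (∑< n h) ↔ Σ ℕ (λ γ → γ < n × Fin (h γ))
Fin-∑< zero    h = mk↔ₛ′ (λ ()) (λ ()) (λ ()) (λ ())
Fin-∑< (suc n) h = ↔-trans +↔⊎ (↔-trans (↔-refl ⊎-↔ Fin-∑< n (h ∘ suc)) split-0)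
  where
  to : Fin (h 0) ⊎ Σ ℕ (λ γ → γ < n × Fin (h (suc γ))) → Σ ℕ (λ γ → γ < suc n × Fin (h γ))
  to (inj₁ x)             = 0 , z<s , x
  to (inj₂ (γ , γ<n , x)) = suc γ , s<s γ<n , x
  from : Σ ℕ (λ γ → γ < suc n × Fin (h γ)) → Fin (h 0) ⊎ Σ ℕ (λ γ → γ < n × Fin (h (suc γ)))
  from (zero  , _         , x) = inj₁ x
  from (suc γ , s<s γ<n , x) = inj₂ (γ , γ<n , x)
  split-0 : (Fin (h 0) ⊎ Σ ℕ (λ γ → γ < n × Fin (h (suc γ)))) ↔ Σ ℕ (λ γ → γ < suc n × Fin (h γ))
  split-0 = mk↔ₛ′ to from
    (λ { (zero , s<s z≤n , x) → refl ; (suc γ , s<s γ<n , x) → refl })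
    (λ { (inj₁ x) → refl ; (inj₂ y) → refl })

Fin-[]· : ∀ c x → Fin ([ c ]· x) ↔ (T c × Fin x)
Fin-[]· true  x = mk↔ₛ′ (tt ,_) proj₂ (λ _ → refl) (λ _ → refl)
Fin-[]· false x = mk↔ₛ′ (λ ()) (λ ()) (λ ()) (λ ())

deduplicate-↭ : ∀ {A : Set} (_≟_ : DecidableEquality A) {xs ys} →
  Unique ys → xs ⊆ ys → ys ⊆ xs → deduplicate _≟_ xs ↭ ys
deduplicate-↭ _≟_ {xs} ys! xs⊆ys ys⊆xs = ∼bag⇒↭ (unique∧set⇒bag (deduplicate-! _≟_ xs) ys!
  (mk⇔ (xs⊆ys ∘ ∈-deduplicate⁻ _≟_ xs) (∈-deduplicate⁺ _≟_ ∘ ys⊆xs)))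

++-⊆ : ∀ {A : Set} {xs ys zs : List A} → xs ⊆ zs → ys ⊆ zs → xs ++ ys ⊆ zs
++-⊆ {xs = xs} xs⊆zs ys⊆zs = [ xs⊆zs , ys⊆zs ]′ ∘ ∈-++⁻ xs

_[_↦_] : (ℕ → ℕ) → ℕ → ℕ → ℕ → ℕ
(f [ n ↦ g ]) i = if i ≡ᵇ n then g else f i

-- chains lo f N counts the sequences lo ≤ γ₀ ≤ γ₁ ≤ ⋯ ≤ γ_{N-1} ≤ f N with γₜ ≤ f t for all t.
chains : ℕ → (ℕ → ℕ) → ℕ → ℕ
chains lo f zero    = [ lo ≤ᵇ f 0 ]· 1
chains lo f (suc N) = ∑< (suc (f 0)) (λ γ → [ lo ≤ᵇ γ ]· chains γ (f ∘ suc) N)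

chains-last : ∀ N lo f →
  chains lo f (suc N) ≡ ∑< (suc (f N)) (λ γ → [ γ ≤ᵇ f (suc N) ]· chains lo (f [ N ↦ γ ]) N)
chains-last zero    lo f = ∑<-ext (suc (f 0)) (λ γ → []·-comm (lo ≤ᵇ γ) (γ ≤ᵇ f 1) 1)
chains-last (suc N) lo f =
  trans (∑<-ext (suc (f 0)) (λ γ → cong ([ lo ≤ᵇ γ ]·_) (chains-last N γ (f ∘ suc))))
        (∑<-comm-guarded (suc (f 0)) (suc (f (suc N))) (lo ≤ᵇ_) (_≤ᵇ f (suc (suc N)))
                         (λ g γ → chains g ((f ∘ suc) [ N ↦ γ ]) N))

Fin-chains-suc : ∀ N f →
  Fin (chains 0 f (suc N)) ↔ Σ ℕ (λ γ → (γ ≤ f N × γ ≤ f (suc N)) × Fin (chains 0 (f [ N ↦ γ ]) N))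
Fin-chains-suc N f = begin
  Fin (chains 0 f (suc N))
    ≡⟨ cong Fin (chains-last N 0 f) ⟩
  Fin (∑< (suc (f N)) (λ γ → [ γ ≤ᵇ f (suc N) ]· chains 0 (f [ N ↦ γ ]) N))
    ↔⟨ Fin-∑< (suc (f N)) _ ⟩
  Σ ℕ (λ γ → γ < suc (f N) × Fin ([ γ ≤ᵇ f (suc N) ]· chains 0 (f [ N ↦ γ ]) N))
    ↔⟨ Σ-↔ ↔-refl (↔-trans (↔-refl ×-↔ Fin-[]· _ _) bounds-↔) ⟩
  Σ ℕ (λ γ → (γ ≤ f N × γ ≤ f (suc N)) × Fin (chains 0 (f [ N ↦ γ ]) N)) ∎
  where
  open Related.EquationalReasoning
  bounds-↔ : ∀ {γ X Y} {A : Set} → (γ < suc X × T (γ ≤ᵇ Y) × A) ↔ ((γ ≤ X × γ ≤ Y) × A)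
  bounds-↔ {γ} {X} {Y} = mk↔ₛ′
    (λ (γ<1+X , γ≤ᵇY , a) → (s≤s⁻¹ γ<1+X , ≤ᵇ⇒≤ γ Y γ≤ᵇY) , a)
    (λ ((γ≤X , γ≤Y) , a) → s≤s γ≤X , ≤⇒≤ᵇ γ≤Y , a)
    (λ _ → cong₂ (λ p q → (p , q) , _) (≤-irrelevant _ _) (≤-irrelevant _ _))
    (λ _ → cong₂ (λ p q → p , q , _) (≤-irrelevant _ _) (T-irrelevant _ _))

lookupℕ : ∀ {n} → Vec ℕ n → ℕ → ℕ
lookupℕ []       i       = 0
lookupℕ (x ∷ xs) zero    = x
lookupℕ (x ∷ xs) (suc i) = lookupℕ xs i

∑-cong : ∀ n {h h′ : Fin n → ℕ} → (∀ k → h k ≡ h′ k) → ∑ h ≡ ∑ h′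
∑-cong zero    eq = refl
∑-cong (suc n) eq = cong₂ _+_ (eq zero) (∑-cong n (eq ∘ Fin.suc))

∑-∑< : ∀ n (h : ℕ → ℕ) → ∑ {n} (h ∘ toℕ) ≡ ∑< n h
∑-∑< zero    h = refl
∑-∑< (suc n) h = cong (h 0 +_) (∑-∑< n (h ∘ suc))

toℕ≤ : ∀ {n} (i : Fin (suc n)) → toℕ i ≤ n
toℕ≤ i = s≤s⁻¹ (toℕ<n i)

L-entry : ∀ a b (p : Fin (suc a)) (k : Fin (suc b)) → L a b p k ≡ [ a ∸ toℕ p + toℕ k ≤ᵇ b ]· 1
L-entry a b p k = begin
  L a b p k
    ≡⟨ ∑-∑< (suc a) (λ l → [ toℕ p + l ≡ᵇ a ]· 1 * [ l + toℕ k ≤ᵇ b ]· 1) ⟩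
  ∑< (suc a) (λ l → [ toℕ p + l ≡ᵇ a ]· 1 * [ l + toℕ k ≤ᵇ b ]· 1)
    ≡⟨ ∑<-ext (suc a) (λ l → trans ([]·1-* (toℕ p + l ≡ᵇ a) _)
                                    (cong ([_]· [ l + toℕ k ≤ᵇ b ]· 1) (+-≡ᵇ (toℕ p) (toℕ≤ p)))) ⟩
  ∑< (suc a) (λ l → [ l ≡ᵇ a ∸ toℕ p ]· [ l + toℕ k ≤ᵇ b ]· 1)
    ≡⟨ ∑<-select (suc a) (a ∸ toℕ p) (λ l → [ l + toℕ k ≤ᵇ b ]· 1) (s≤s (m∸n≤m a (toℕ p))) ⟩
  [ a ∸ toℕ p + toℕ k ≤ᵇ b ]· 1 ∎
  where open ≡-Reasoning

Lchain-entry : ∀ r a (bs : Vec ℕ (suc r)) (p : Fin (suc a)) (j : Fin (suc (lastV bs))) →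
  Lchain a bs p j ≡ chains (a ∸ toℕ p) (lookupℕ (bs [ fromℕ r ]≔ (lastV bs ∸ toℕ j))) r
Lchain-entry zero a (b ∷ []) p j =
  trans (L-entry a b p j) (cong ([_]· 1) (+-≤ᵇ (a ∸ toℕ p) (toℕ≤ j)))
Lchain-entry (suc r) a (b ∷ c ∷ cs) p j = begin
  ∑ {suc b} (λ k → L a b p k * Lchain b (c ∷ cs) k j)
    ≡⟨ ∑-cong (suc b) (λ k → cong₂ _*_ (L-entry a b p k) (Lchain-entry r b (c ∷ cs) k j)) ⟩
  ∑ {suc b} (λ k → [ a ∸ toℕ p + toℕ k ≤ᵇ b ]· 1 * chains (b ∸ toℕ k) f r)
    ≡⟨ ∑-∑< (suc b) (λ k → [ a ∸ toℕ p + k ≤ᵇ b ]· 1 * chains (b ∸ k) f r) ⟩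
  ∑< (suc b) (λ k → [ a ∸ toℕ p + k ≤ᵇ b ]· 1 * chains (b ∸ k) f r)
    ≡⟨ ∑<-cong (suc b) (λ {k} k<1+b → trans ([]·1-* _ (chains (b ∸ k) f r))
                                            (cong ([_]· chains (b ∸ k) f r) (+-≤ᵇ (a ∸ toℕ p) (s≤s⁻¹ k<1+b)))) ⟩
  ∑< (suc b) (λ k → F (b ∸ k))
    ≡⟨ ∑<-reverse b F ⟨
  ∑< (suc b) F ∎
  where
  open ≡-Reasoning
  f : ℕ → ℕ
  f = lookupℕ ((c ∷ cs) [ fromℕ r ]≔ (lastV (c ∷ cs) ∸ toℕ j))
  F : ℕ → ℕ
  F γ = [ a ∸ toℕ p ≤ᵇ γ ]· chains γ f r

R⊗R-entry : ∀ m₀ m₁ (i : Fin (suc m₀)) (q : Fin (suc m₁)) →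
  (R m₀ m₀ ⊗ R m₀ m₁) i q ≡ ∑< (suc (m₀ ∸ toℕ i)) (λ l → [ l ≤ᵇ m₁ ∸ toℕ q ]· 1)
R⊗R-entry m₀ m₁ i q = begin
  (R m₀ m₀ ⊗ R m₀ m₁) i q
    ≡⟨ ∑-∑< (suc m₀) (λ l → [ toℕ i + l ≤ᵇ m₀ ]· 1 * [ l + toℕ q ≤ᵇ m₁ ]· 1) ⟩
  ∑< (suc m₀) (λ l → [ toℕ i + l ≤ᵇ m₀ ]· 1 * [ l + toℕ q ≤ᵇ m₁ ]· 1)
    ≡⟨ ∑<-ext (suc m₀) (λ l → trans ([]·1-* (toℕ i + l ≤ᵇ m₀) _)
                                    (cong₂ (λ c d → [ c ]· [ d ]· 1) (+-≤ᵇ′ l (toℕ≤ i)) (+-≤ᵇ l (toℕ≤ q)))) ⟩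
  ∑< (suc m₀) (λ l → [ l ≤ᵇ m₀ ∸ toℕ i ]· [ l ≤ᵇ m₁ ∸ toℕ q ]· 1)
    ≡⟨ ∑<-truncate (suc m₀) (m₀ ∸ toℕ i) (λ l → [ l ≤ᵇ m₁ ∸ toℕ q ]· 1) (s≤s (m∸n≤m m₀ (toℕ i))) ⟩
  ∑< (suc (m₀ ∸ toℕ i)) (λ l → [ l ≤ᵇ m₁ ∸ toℕ q ]· 1) ∎
  where open ≡-Reasoning

X-entry : ∀ k (m : Vec ℕ (suc (suc k))) (i : Fin (suc (headV m))) (j : Fin (suc (lastV m))) →
  X m i j ≡ chains 0 (lookupℕ ((m [ zero ]≔ (headV m ∸ toℕ i)) [ fromℕ (suc k) ]≔ (lastV m ∸ toℕ j))) (suc k)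
X-entry zero    (m₀ ∷ m₁ ∷ [])      i j = R⊗R-entry m₀ m₁ i j
X-entry (suc k) (m₀ ∷ m₁ ∷ m₂ ∷ ms) i j = begin
  ∑ {suc m₁} (λ q → (R m₀ m₀ ⊗ R m₀ m₁) i q * Lchain m₁ (m₂ ∷ ms) q j)
    ≡⟨ ∑-cong (suc m₁) (λ q → cong₂ _*_ (R⊗R-entry m₀ m₁ i q) (Lchain-entry k m₁ (m₂ ∷ ms) q j)) ⟩
  ∑ {suc m₁} (λ q → F (m₁ ∸ toℕ q))
    ≡⟨ ∑-∑< (suc m₁) (λ q → F (m₁ ∸ q)) ⟩
  ∑< (suc m₁) (λ q → F (m₁ ∸ q))
    ≡⟨ ∑<-reverse m₁ F ⟨
  ∑< (suc m₁) F
    ≡⟨ ∑<-ext (suc m₁) (λ γ → trans (∑<-*ʳ (suc x₀) (λ l → [ l ≤ᵇ γ ]· 1) (chains γ f k))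
                                    (∑<-ext (suc x₀) (λ l → []·1-* (l ≤ᵇ γ) (chains γ f k)))) ⟩
  ∑< (suc m₁) (λ γ → ∑< (suc x₀) (λ l → [ l ≤ᵇ γ ]· chains γ f k))
    ≡⟨ ∑<-comm (suc m₁) (suc x₀) (λ γ l → [ l ≤ᵇ γ ]· chains γ f k) ⟩
  ∑< (suc x₀) (λ l → ∑< (suc m₁) (λ γ → [ l ≤ᵇ γ ]· chains γ f k)) ∎
  where
  open ≡-Reasoning
  x₀ = m₀ ∸ toℕ i
  f : ℕ → ℕ
  f = lookupℕ ((m₂ ∷ ms) [ fromℕ k ]≔ (lastV (m₂ ∷ ms) ∸ toℕ j))
  F : ℕ → ℕ
  F γ = ∑< (suc x₀) (λ l → [ l ≤ᵇ γ ]· 1) * chains γ f k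

-- Mixed dimer covers of an explicit list of edges and vertices

Covers′ : List Edge → List Point → (Point → ℕ) → Set
Covers′ es vs ℓ = Σ (Vec ℕ (length es)) (λ ω → All (λ v → incSum v es ω ≡ ℓ v) vs)

All-≡-irrelevant : ∀ {F G : Point → ℕ} {vs} → Irrelevant (All (λ v → F v ≡ G v) vs)
All-≡-irrelevant = All.irrelevant ≡-irrelevant

Covers′-cong : ∀ {es vs ℓ ℓ′} → All (λ v → ℓ v ≡ ℓ′ v) vs → Covers′ es vs ℓ ↔ Covers′ es vs ℓ′
Covers′-cong ℓ≗ℓ′ = Σ-irrelevant-↔ All-≡-irrelevant All-≡-irrelevant id id
  (λ p → All.zipWith (λ (e , e′) → trans e e′) (p , ℓ≗ℓ′))
  (λ p → All.zipWith (λ (e , e′) → trans e (sym e′)) (p , ℓ≗ℓ′))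
  (λ _ → refl) (λ _ → refl)

permuteʷ : ∀ {es fs : List Edge} → es ↭ fs → Vec ℕ (length es) → Vec ℕ (length fs)
permuteʷ ↭.refl          ω           = ω
permuteʷ (↭.prep e π)    (x ∷ ω)     = x ∷ permuteʷ π ω
permuteʷ (↭.swap e f π)  (x ∷ y ∷ ω) = y ∷ x ∷ permuteʷ π ω
permuteʷ (↭.trans π π′)  ω           = permuteʷ π′ (permuteʷ π ω)

incSum-permuteʷ : ∀ v {es fs} (π : es ↭ fs) ω → incSum v fs (permuteʷ π ω) ≡ incSum v es ω
incSum-permuteʷ v ↭.refl          ω           = refl
incSum-permuteʷ v (↭.prep e π)    (x ∷ ω)     = cong (_ +_) (incSum-permuteʷ v π ω)
incSum-permuteʷ v (↭.swap e f π)  (x ∷ y ∷ ω) =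
  trans (cong (λ s → [ incident v f ]· y + ([ incident v e ]· x + s)) (incSum-permuteʷ v π ω))
        (x∙yz≈y∙xz ([ incident v f ]· y) ([ incident v e ]· x) _)
incSum-permuteʷ v (↭.trans π π′)  ω           = trans (incSum-permuteʷ v π′ _) (incSum-permuteʷ v π ω)

permuteʷ-sym : ∀ {es fs} (π : es ↭ fs) ω → permuteʷ (↭-sym π) (permuteʷ π ω) ≡ ω
permuteʷ-sym ↭.refl          ω           = refl
permuteʷ-sym (↭.prep e π)    (x ∷ ω)     = cong (x ∷_) (permuteʷ-sym π ω)
permuteʷ-sym (↭.swap e f π)  (x ∷ y ∷ ω) = cong (λ ω′ → x ∷ y ∷ ω′) (permuteʷ-sym π ω)
permuteʷ-sym (↭.trans π π′)  ω           =
  trans (cong (permuteʷ (↭-sym π)) (permuteʷ-sym π′ _)) (permuteʷ-sym π ω)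

Covers′-resp-↭ : ∀ {es fs vs us ℓ} → es ↭ fs → vs ↭ us → Covers′ es vs ℓ ↔ Covers′ fs us ℓ
Covers′-resp-↭ π ρ = Σ-irrelevant-↔ All-≡-irrelevant All-≡-irrelevant
  (permuteʷ π) (permuteʷ (↭-sym π))
  (λ p → All-resp-↭ ρ (All.map (trans (incSum-permuteʷ _ π _)) p))
  (λ p → All-resp-↭ (↭-sym ρ) (All.map (trans (incSum-permuteʷ _ (↭-sym π) _)) p))
  (λ _ → permuteʷ-sym π _)
  (λ {ω} _ → trans (cong (λ π′ → permuteʷ π′ (permuteʷ (↭-sym π) ω)) (sym (↭-sym-involutive π)))
                   (permuteʷ-sym (↭-sym π) ω))

takeʷ : ∀ (es fs : List Edge) → Vec ℕ (length (es ++ fs)) → Vec ℕ (length es)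
takeʷ []       fs ω       = []
takeʷ (e ∷ es) fs (x ∷ ω) = x ∷ takeʷ es fs ω

dropʷ : ∀ (es fs : List Edge) → Vec ℕ (length (es ++ fs)) → Vec ℕ (length fs)
dropʷ []       fs ω       = ω
dropʷ (e ∷ es) fs (x ∷ ω) = dropʷ es fs ω

joinʷ : ∀ (es fs : List Edge) → Vec ℕ (length es) → Vec ℕ (length fs) → Vec ℕ (length (es ++ fs))
joinʷ []       fs []      ω′ = ω′
joinʷ (e ∷ es) fs (x ∷ ω) ω′ = x ∷ joinʷ es fs ω ω′

takeʷ-joinʷ : ∀ (es fs : List Edge) ω ω′ → takeʷ es fs (joinʷ es fs ω ω′) ≡ ω
takeʷ-joinʷ []       fs []      ω′ = refl
takeʷ-joinʷ (e ∷ es) fs (x ∷ ω) ω′ = cong (x ∷_) (takeʷ-joinʷ es fs ω ω′)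

dropʷ-joinʷ : ∀ (es fs : List Edge) ω ω′ → dropʷ es fs (joinʷ es fs ω ω′) ≡ ω′
dropʷ-joinʷ []       fs []      ω′ = refl
dropʷ-joinʷ (e ∷ es) fs (x ∷ ω) ω′ = dropʷ-joinʷ es fs ω ω′

joinʷ-split : ∀ (es fs : List Edge) ω → joinʷ es fs (takeʷ es fs ω) (dropʷ es fs ω) ≡ ω
joinʷ-split []       fs ω       = refl
joinʷ-split (e ∷ es) fs (x ∷ ω) = cong (x ∷_) (joinʷ-split es fs ω)

incSum-++ : ∀ v (es fs : List Edge) ω →
  incSum v (es ++ fs) ω ≡ incSum v es (takeʷ es fs ω) + incSum v fs (dropʷ es fs ω)
incSum-++ v []       fs ω       = refl
incSum-++ v (e ∷ es) fs (x ∷ ω) =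
  trans (cong ([ incident v e ]· x +_) (incSum-++ v es fs ω)) (sym (+-assoc ([ incident v e ]· x) _ _))

Covers′-++ : ∀ (es fs : List Edge) {vs : List Point} {ℓ : Point → ℕ} → Covers′ (es ++ fs) vs ℓ ↔
  Σ (Vec ℕ (length es) × Vec ℕ (length fs)) (λ (ω , ω′) → All (λ v → incSum v es ω + incSum v fs ω′ ≡ ℓ v) vs)
Covers′-++ es fs = Σ-irrelevant-↔ All-≡-irrelevant All-≡-irrelevant split join
  (λ {ω} → All.map (λ {v} → trans (sym (incSum-++ v es fs ω))))
  (λ {(ω , ω′)} → All.map (λ {v} → trans (incSum-joinʷ v ω ω′)))
  (λ {ω} _ → joinʷ-split es fs ω)
  (λ {(ω , ω′)} _ → cong₂ _,_ (takeʷ-joinʷ es fs ω ω′) (dropʷ-joinʷ es fs ω ω′))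
  where
  split : Vec ℕ (length (es ++ fs)) → Vec ℕ (length es) × Vec ℕ (length fs)
  split ω = takeʷ es fs ω , dropʷ es fs ω
  join : Vec ℕ (length es) × Vec ℕ (length fs) → Vec ℕ (length (es ++ fs))
  join (ω , ω′) = joinʷ es fs ω ω′
  incSum-joinʷ : ∀ v ω ω′ → incSum v (es ++ fs) (joinʷ es fs ω ω′) ≡ incSum v es ω + incSum v fs ω′
  incSum-joinʷ v ω ω′ = trans (incSum-++ v es fs _)
    (cong₂ (λ ω₁ ω₂ → incSum v es ω₁ + incSum v fs ω₂) (takeʷ-joinʷ es fs ω ω′) (dropʷ-joinʷ es fs ω ω′))

incident-≢ : ∀ {v p q} → p ≢ v → q ≢ v → incident v (p , q) ≡ false
incident-≢ {v} {p} {q} p≢v q≢v rewrite ⌊⌋-false (p ≟P v) p≢v | ⌊⌋-false (q ≟P v) q≢v = refl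

incident-₁ : ∀ v q → incident v (v , q) ≡ true
incident-₁ v q rewrite ⌊⌋-true (v ≟P v) refl = refl

incident-₂ : ∀ p v → incident v (p , v) ≡ true
incident-₂ p v rewrite ⌊⌋-true (v ≟P v) refl = ∨-zeroʳ _

incSum-isolated : ∀ {v es} → All (λ e → incident v e ≡ false) es → ∀ ω → incSum v es ω ≡ 0
incSum-isolated []           []      = refl
incSum-isolated (v∉e ∷ v∉es) (x ∷ ω) rewrite v∉e = incSum-isolated v∉es ω

relabel : Point → Point → ℕ → (Point → ℕ) → Point → ℕ
relabel a b g ℓ v = if ⌊ a ≟P v ⌋ ∨ ⌊ b ≟P v ⌋ then g else ℓ v

relabel-a : ∀ a b g ℓ → relabel a b g ℓ a ≡ g
relabel-a a b g ℓ rewrite ⌊⌋-true (a ≟P a) refl = refl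

relabel-b : ∀ a b g ℓ → relabel a b g ℓ b ≡ g
relabel-b a b g ℓ rewrite ⌊⌋-true (b ≟P b) refl | ∨-zeroʳ ⌊ a ≟P b ⌋ = refl

relabel-≢ : ∀ {a b v} g ℓ → a ≢ v → b ≢ v → relabel a b g ℓ v ≡ ℓ v
relabel-≢ {a} {b} {v} g ℓ a≢v b≢v rewrite ⌊⌋-false (a ≟P v) a≢v | ⌊⌋-false (b ≟P v) b≢v = refl

+-cancel-⇔ : ∀ {n x z X} → x + z ≡ X → (n + x ≡ X ⇔ n ≡ z)
+-cancel-⇔ {n} {x} {z} refl = mk⇔ (λ eq → +-cancelʳ-≡ x n z (trans eq (+-comm x z))) (λ { refl → +-comm z x })

newSides : Point → Point → Point → Point → List Edge
newSides a b u w = (a , u) ∷ (b , w) ∷ (u , w) ∷ []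

module _ {a b u w : Point} (x y z : ℕ) where

  newSides-at-a : b ≢ a → u ≢ a → w ≢ a → incSum a (newSides a b u w) (x ∷ y ∷ z ∷ []) ≡ x
  newSides-at-a b≢a u≢a w≢a
    rewrite incident-₁ a u | incident-≢ b≢a w≢a | incident-≢ u≢a w≢a = +-identityʳ x

  newSides-at-b : a ≢ b → u ≢ b → w ≢ b → incSum b (newSides a b u w) (x ∷ y ∷ z ∷ []) ≡ y
  newSides-at-b a≢b u≢b w≢b
    rewrite incident-≢ a≢b u≢b | incident-₁ b w | incident-≢ u≢b w≢b = +-identityʳ y

  newSides-at-u : b ≢ u → w ≢ u → incSum u (newSides a b u w) (x ∷ y ∷ z ∷ []) ≡ x + z
  newSides-at-u b≢u w≢u
    rewrite incident-₂ a u | incident-≢ b≢u w≢u | incident-₁ u w = cong (x +_) (+-identityʳ z)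

  newSides-at-w : a ≢ w → u ≢ w → incSum w (newSides a b u w) (x ∷ y ∷ z ∷ []) ≡ y + z
  newSides-at-w a≢w u≢w
    rewrite incident-≢ a≢w u≢w | incident-₂ b w | incident-₂ u w = cong (y +_) (+-identityʳ z)

  newSides-elsewhere : ∀ {v} → a ≢ v → b ≢ v → u ≢ v → w ≢ v →
    incSum v (newSides a b u w) (x ∷ y ∷ z ∷ []) ≡ 0
  newSides-elsewhere a≢v b≢v u≢v w≢v
    rewrite incident-≢ a≢v u≢v | incident-≢ b≢v w≢v | incident-≢ u≢v w≢v = refl

-- The demands X at u and Y at w force the weights X ∸ g and Y ∸ g on (a , u) and (b , w), where g is
-- the weight of (u , w); what remains at a and at b is the demand g.
module Gluing {es : List Edge} {vs : List Point} {a b u w : Point} {ℓ : Point → ℕ} {X Y : ℕ}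
  (a≢b : a ≢ b) (b≢u : b ≢ u) (a≢w : a ≢ w) (u≢w : u ≢ w) (u∉vs : u ∉ vs) (w∉vs : w ∉ vs)
  (u-isolated : All (λ e → incident u e ≡ false) es) (w-isolated : All (λ e → incident w e ≡ false) es)
  (ℓa : ℓ a ≡ X) (ℓb : ℓ b ≡ Y) (ℓu : ℓ u ≡ X) (ℓw : ℓ w ≡ Y) where

  private
    E = newSides a b u w

    relabel-⇔ : ∀ {v} n {x y z} → v ≢ u → v ≢ w → x + z ≡ X → y + z ≡ Y →
      (n + incSum v E (x ∷ y ∷ z ∷ []) ≡ ℓ v) ⇔ (n ≡ relabel a b z ℓ v)
    relabel-⇔ {v} n {x} {y} {z} v≢u v≢w x+z≡X y+z≡Y with v ≟P a | v ≟P b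
    ... | yes refl | _ rewrite newSides-at-a x y z (a≢b ∘ sym) (v≢u ∘ sym) (v≢w ∘ sym)
                             | relabel-a a b z ℓ | ℓa = +-cancel-⇔ x+z≡X
    ... | no v≢a | yes refl rewrite newSides-at-b x y z a≢b (v≢u ∘ sym) (v≢w ∘ sym)
                                  | relabel-b a b z ℓ | ℓb = +-cancel-⇔ y+z≡Y
    ... | no v≢a | no v≢b
      rewrite newSides-elsewhere x y z (v≢a ∘ sym) (v≢b ∘ sym) (v≢u ∘ sym) (v≢w ∘ sym)
            | relabel-≢ z ℓ (v≢a ∘ sym) (v≢b ∘ sym) | +-identityʳ n = mk⇔ id id

    fresh : All (λ v → v ≢ u × v ≢ w) vs
    fresh = All.tabulate (λ v∈vs → (λ { refl → u∉vs v∈vs }) , (λ { refl → w∉vs v∈vs }))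

    P : Vec ℕ (length es) × Vec ℕ 3 → Set
    P (ω , d) = All (λ v → incSum v es ω + incSum v E d ≡ ℓ v) (vs ++ u ∷ w ∷ [])

    Q : ℕ × Vec ℕ (length es) → Set
    Q (g , ω) = (g ≤ X × g ≤ Y) × All (λ v → incSum v es ω ≡ relabel a b g ℓ v) vs

    Q-irrelevant : ∀ {q} → Irrelevant (Q q)
    Q-irrelevant ((p₁ , p₂) , p₃) ((q₁ , q₂) , q₃) =
      cong₂ _,_ (cong₂ _,_ (≤-irrelevant p₁ q₁) (≤-irrelevant p₂ q₂)) (All-≡-irrelevant p₃ q₃)

    at-u : ∀ ω x y z → incSum u es ω + incSum u E (x ∷ y ∷ z ∷ []) ≡ x + z
    at-u ω x y z = trans (cong (_+ _) (incSum-isolated u-isolated ω)) (newSides-at-u {a = a} x y z b≢u (u≢w ∘ sym))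

    at-w : ∀ ω x y z → incSum w es ω + incSum w E (x ∷ y ∷ z ∷ []) ≡ y + z
    at-w ω x y z = trans (cong (_+ _) (incSum-isolated w-isolated ω)) (newSides-at-w {b = b} x y z a≢w u≢w)

    forced : ∀ ω x y z → P (ω , x ∷ y ∷ z ∷ []) → x + z ≡ X × y + z ≡ Y
    forced ω x y z p with All.++⁻ʳ vs p
    ... | pu ∷ pw ∷ [] = trans (sym (at-u ω x y z)) (trans pu ℓu) , trans (sym (at-w ω x y z)) (trans pw ℓw)

    to : Vec ℕ (length es) × Vec ℕ 3 → ℕ × Vec ℕ (length es)
    to (ω , x ∷ y ∷ z ∷ []) = z , ω

    from : ℕ × Vec ℕ (length es) → Vec ℕ (length es) × Vec ℕ 3
    from (g , ω) = ω , (X ∸ g) ∷ (Y ∸ g) ∷ g ∷ []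

    toP : ∀ {p} → P p → Q (to p)
    toP {ω , x ∷ y ∷ z ∷ []} p =
      (subst (z ≤_) x+z≡X (m≤n+m z x) , subst (z ≤_) y+z≡Y (m≤n+m z y)) ,
      All.zipWith (λ (e , v≢u , v≢w) → Equivalence.to (relabel-⇔ _ v≢u v≢w x+z≡X y+z≡Y) e)
                  (All.++⁻ˡ vs p , fresh)
      where
      x+z≡X = proj₁ (forced ω x y z p)
      y+z≡Y = proj₂ (forced ω x y z p)

    fromQ : ∀ {q} → Q q → P (from q)
    fromQ {g , ω} ((g≤X , g≤Y) , p) = All.++⁺
      (All.zipWith (λ (e , v≢u , v≢w) → Equivalence.from (relabel-⇔ _ v≢u v≢w X∸g+g≡X Y∸g+g≡Y) e) (p , fresh))
      (trans (at-u ω (X ∸ g) (Y ∸ g) g) (trans X∸g+g≡X (sym ℓu)) ∷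
       trans (at-w ω (X ∸ g) (Y ∸ g) g) (trans Y∸g+g≡Y (sym ℓw)) ∷ [])
      where
      X∸g+g≡X = m∸n+n≡m g≤X
      Y∸g+g≡Y = m∸n+n≡m g≤Y

    from∘to : ∀ {p} → P p → from (to p) ≡ p
    from∘to {ω , x ∷ y ∷ z ∷ []} p = cong₂ (λ x′ y′ → ω , x′ ∷ y′ ∷ z ∷ [])
      (trans (cong (_∸ z) (sym (proj₁ (forced ω x y z p)))) (m+n∸n≡m x z))
      (trans (cong (_∸ z) (sym (proj₂ (forced ω x y z p)))) (m+n∸n≡m y z))

  Covers′-glue : Covers′ (es ++ newSides a b u w) (vs ++ u ∷ w ∷ []) ℓ ↔
                 Σ ℕ (λ g → (g ≤ X × g ≤ Y) × Covers′ es vs (relabel a b g ℓ))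
  Covers′-glue = ↔-trans (Covers′-++ es E)
    (↔-trans (Σ-irrelevant-↔ {P = P} {Q = Q} All-≡-irrelevant Q-irrelevant to from
                 (λ {p} → toP {p}) (λ {q} → fromQ {q}) (λ {p} → from∘to {p}) (λ _ → refl))
             Σ-×-assoc-↔)

-- The zigzag snake

shift : Point → Point
shift x = suc (proj₁ x) , suc (proj₂ x)

-- The tile T_{k+1} has corners spine k, spine (k + 1), outer k and spine (k + 2); it is glued to T_k along
-- the side (spine k , spine (k + 1)), and the pair P_k of the paper is {spine k , outer k}.
spine outer : ℕ → Point
spine zero          = 0 , 0
spine (suc zero)    = 0 , 1
spine (suc (suc k)) = shift (spine k)
outer zero          = 1 , 0
outer (suc zero)    = 0 , 2
outer (suc (suc k)) = shift (outer k)

sharedSide : ℕ → Edge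
sharedSide k = spine k , spine (suc k)

newVertices : ℕ → List Point
newVertices k = outer k ∷ spine (suc (suc k)) ∷ []

newEdges : ℕ → List Edge
newEdges k = newSides (spine k) (spine (suc k)) (outer k) (spine (suc (suc k)))

corners-spine : ∀ k → corners (spine k) ↭ spine k ∷ spine (suc k) ∷ newVertices k
corners-spine zero          = ↭.prep _ (↭.swap _ _ ↭.refl)
corners-spine (suc zero)    = ↭.refl
corners-spine (suc (suc k)) = map⁺ shift (corners-spine k)

sides-spine : ∀ k → sides (spine k) ↭ sharedSide k ∷ newEdges k
sides-spine zero          = ↭-shift (sharedSide 0) (_ ∷ _ ∷ []) (_ ∷ [])
sides-spine (suc zero)    = ↭.prep _ (↭-sym (↭-shift _ (_ ∷ _ ∷ []) []))
sides-spine (suc (suc k)) = map⁺ (λ e → shift (proj₁ e) , shift (proj₂ e)) (sides-spine k)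

data Parity : ℕ → Set where
  even : ∀ j → Parity (j + j)
  odd  : ∀ j → Parity (suc (j + j))

parity : ∀ n → Parity n
parity zero = even zero
parity (suc n) with parity n
... | even j = odd j
... | odd j  = subst Parity (cong suc (+-suc j j)) (even (suc j))

spine-even : ∀ j → spine (j + j) ≡ (j , j)
spine-even zero    = refl
spine-even (suc j) rewrite +-suc j j = cong shift (spine-even j)

spine-odd : ∀ j → spine (suc (j + j)) ≡ (j , suc j)
spine-odd zero    = refl
spine-odd (suc j) rewrite +-suc j j = cong shift (spine-odd j)

outer-even : ∀ j → outer (j + j) ≡ (suc j , j)
outer-even zero    = refl
outer-even (suc j) rewrite +-suc j j = cong shift (outer-even j)

outer-odd : ∀ j → outer (suc (j + j)) ≡ (j , suc (suc j))
outer-odd zero    = refl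
outer-odd (suc j) rewrite +-suc j j = cong shift (outer-odd j)

/2-suc-suc : ∀ n → suc (suc n) / 2 ≡ suc (n / 2)
/2-suc-suc n = m/n≡1+[m∸n]/n {suc (suc n)} {2} (s≤s (s≤s z≤n))

even-%2 : ∀ j → (j + j) % 2 ≡ 0
even-%2 zero    = refl
even-%2 (suc j) rewrite +-suc j j = even-%2 j

even-/2 : ∀ j → (j + j) / 2 ≡ j
even-/2 zero    = refl
even-/2 (suc j) rewrite +-suc j j = trans (/2-suc-suc (j + j)) (cong suc (even-/2 j))

odd-%2 : ∀ j → suc (j + j) % 2 ≡ 1
odd-%2 zero    = refl
odd-%2 (suc j) rewrite +-suc j j = odd-%2 j

odd-/2 : ∀ j → suc (j + j) / 2 ≡ j
odd-/2 zero    = refl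
odd-/2 (suc j) rewrite +-suc j j = trans (/2-suc-suc (suc (j + j))) (cong suc (odd-/2 j))

tileLL-spine : ∀ k → tileLL (suc k) ≡ spine k
tileLL-spine k with parity k
... | even j rewrite odd-%2 j | odd-/2 j | spine-even j = refl
... | odd j  rewrite even-%2 j | /2-suc-suc (j + j) | even-/2 j | spine-odd j = refl

pairOf-spine-outer : ∀ k → pairOf (suc k) ≡ spine k ∷ outer k ∷ []
pairOf-spine-outer k with parity k
... | even j rewrite odd-%2 j | odd-/2 j | spine-even j | outer-even j = refl
... | odd j  rewrite even-%2 j | /2-suc-suc (j + j) | even-/2 j | spine-odd j | outer-odd j = refl

tiles-suc : ∀ N → tiles (suc N) ≡ tiles N ++ spine N ∷ []
tiles-suc N = begin
  map (tileLL ∘ suc) (upTo (suc N))      ≡⟨ cong (map (tileLL ∘ suc)) (upTo-∷ʳ N) ⟨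
  map (tileLL ∘ suc) (upTo N ++ N ∷ [])  ≡⟨ map-++ (tileLL ∘ suc) (upTo N) (N ∷ []) ⟩
  tiles N ++ tileLL (suc N) ∷ []         ≡⟨ cong (λ p → tiles N ++ p ∷ []) (tileLL-spine N) ⟩
  tiles N ++ spine N ∷ []                ∎
  where open ≡-Reasoning

concatMap-tiles-suc : ∀ {A : Set} (piece : Point → List A) N →
  concatMap piece (tiles (suc N)) ≡ concatMap piece (tiles N) ++ piece (spine N)
concatMap-tiles-suc piece N = trans (cong (concatMap piece) (tiles-suc N))
  (trans (concatMap-++ piece (tiles N) (spine N ∷ [])) (cong (concatMap piece (tiles N) ++_) (++-identityʳ _)))

-- piece (spine N) consists of the part old N shared with earlier tiles and the part new N added by T_{N+1}.
module Tiling {A : Set} (piece : Point → List A) (old new built : ℕ → List A)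
  (built-zero : built zero ≡ old zero) (built-suc : ∀ N → built (suc N) ≡ built N ++ new N)
  (piece-spine : ∀ N → piece (spine N) ↭ old N ++ new N)
  (old-suc : ∀ N → old (suc N) ⊆ old N ++ new N) where

  private
    raw : ℕ → List A
    raw N = concatMap piece (tiles N)

    piece⊆raw : ∀ N → piece (spine N) ⊆ raw (suc N)
    piece⊆raw N = ⊆.⊆-trans (⊆.xs⊆ys++xs _ (raw N)) (⊆.⊆-reflexive (sym (concatMap-tiles-suc piece N)))

    raw⊆raw-suc : ∀ N → raw N ⊆ raw (suc N)
    raw⊆raw-suc N = ⊆.⊆-trans (⊆.xs⊆xs++ys (raw N) _) (⊆.⊆-reflexive (sym (concatMap-tiles-suc piece N)))

    old⊆built : ∀ N → old N ⊆ built N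
    old⊆built zero    = ⊆.⊆-reflexive (sym built-zero)
    old⊆built (suc N) = ⊆.⊆-trans (old-suc N)
      (⊆.⊆-trans (⊆.++⁺ˡ (new N) (old⊆built N)) (⊆.⊆-reflexive (sym (built-suc N))))

    raw⊆built : ∀ N → raw N ⊆ built N
    raw⊆built zero    ()
    raw⊆built (suc N) = ⊆.⊆-trans (⊆.⊆-reflexive (concatMap-tiles-suc piece N))
      (⊆.⊆-trans (++-⊆ (⊆.⊆-trans (raw⊆built N) (⊆.xs⊆xs++ys _ (new N)))
                       (⊆.⊆-trans (⊆.⊆-reflexive-↭ (piece-spine N)) (⊆.++⁺ˡ (new N) (old⊆built N))))
                 (⊆.⊆-reflexive (sym (built-suc N))))

    mutual
      built⊆raw-suc : ∀ N → built N ⊆ raw (suc N)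
      built⊆raw-suc zero    = ⊆.⊆-trans (⊆.⊆-reflexive built-zero)
        (⊆.⊆-trans (⊆.⊆-trans (⊆.xs⊆xs++ys (old 0) (new 0)) (⊆.⊆-reflexive-↭ (↭-sym (piece-spine 0))))
                   (piece⊆raw 0))
      built⊆raw-suc (suc N) = ⊆.⊆-trans (built-suc⊆raw N) (raw⊆raw-suc (suc N))

      built-suc⊆raw : ∀ N → built (suc N) ⊆ raw (suc N)
      built-suc⊆raw N = ⊆.⊆-trans (⊆.⊆-reflexive (built-suc N))
        (++-⊆ (built⊆raw-suc N)
              (⊆.⊆-trans (⊆.xs⊆ys++xs (new N) (old N))
                         (⊆.⊆-trans (⊆.⊆-reflexive-↭ (↭-sym (piece-spine N))) (piece⊆raw N))))

  deduplicate-tiles-↭ : (_≟_ : DecidableEquality A) → ∀ N → Unique (built (suc N)) →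
    deduplicate _≟_ (concatMap piece (tiles (suc N))) ↭ built (suc N)
  deduplicate-tiles-↭ _≟_ N built! = deduplicate-↭ _≟_ built! (raw⊆built (suc N)) (built-suc⊆raw N)

_≤P_ : Point → Point → Set
x ≤P y = proj₁ x ≤ proj₁ y × proj₂ x ≤ proj₂ y

≤P-refl : ∀ {x} → x ≤P x
≤P-refl = ≤-refl , ≤-refl

≤P-trans : ∀ {x y z} → x ≤P y → y ≤P z → x ≤P z
≤P-trans (p , q) (p′ , q′) = ≤-trans p p′ , ≤-trans q q′

shift-mono : ∀ {x y} → x ≤P y → shift x ≤P shift y
shift-mono (p , q) = s≤s p , s≤s q

shift-cancel : ∀ {x y} → shift x ≤P shift y → x ≤P y
shift-cancel (p , q) = s≤s⁻¹ p , s≤s⁻¹ q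

spine-≤P-suc : ∀ k → spine k ≤P spine (suc k)
spine-≤P-suc zero          = z≤n , z≤n
spine-≤P-suc (suc zero)    = z≤n , s≤s z≤n
spine-≤P-suc (suc (suc k)) = shift-mono (spine-≤P-suc k)

outer-≤P : ∀ k → outer k ≤P spine (suc (suc k))
outer-≤P zero          = s≤s z≤n , z≤n
outer-≤P (suc zero)    = z≤n , s≤s (s≤s z≤n)
outer-≤P (suc (suc k)) = shift-mono (outer-≤P k)

outer-≰P : ∀ k → ¬ outer k ≤P spine (suc k)
outer-≰P zero          (() , _)
outer-≰P (suc zero)    (_ , s≤s ())
outer-≰P (suc (suc k)) = outer-≰P k ∘ shift-cancel

spine-≰P : ∀ k → ¬ spine (suc (suc k)) ≤P spine (suc k)
spine-≰P zero          (() , _)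
spine-≰P (suc zero)    (_ , s≤s ())
spine-≰P (suc (suc k)) = spine-≰P k ∘ shift-cancel

pairIndex : Point → ℕ
pairIndex (p , q) = if q ≤ᵇ p then q + q else suc (p + p)

pairIndex-spine : ∀ k → pairIndex (spine k) ≡ k
pairIndex-spine k with parity k
... | even j rewrite spine-even j | ≤ᵇ-true (≤-refl {j}) = refl
... | odd j  rewrite spine-odd j  | ≤ᵇ-false (≤-refl {suc j}) = refl

pairIndex-outer : ∀ k → pairIndex (outer k) ≡ k
pairIndex-outer k with parity k
... | even j rewrite outer-even j | ≤ᵇ-true (n≤1+n j) = refl
... | odd j  rewrite outer-odd j  | ≤ᵇ-false (m<n⇒m<1+n (≤-refl {suc j})) = refl

pairIndex-≢ : ∀ {v v′ i j} → pairIndex v ≡ i → pairIndex v′ ≡ j → i ≢ j → v ≢ v′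
pairIndex-≢ refl refl i≢j = i≢j ∘ cong pairIndex

InOwnPair : Point → Set
InOwnPair v = (v ∈ᵇ pairOf (suc (pairIndex v))) ≡ true

InOwnPair-spine : ∀ k → InOwnPair (spine k)
InOwnPair-spine k rewrite pairIndex-spine k | pairOf-spine-outer k | ⌊⌋-true (spine k ≟P spine k) refl = refl

InOwnPair-outer : ∀ k → InOwnPair (outer k)
InOwnPair-outer k rewrite pairIndex-outer k | pairOf-spine-outer k | ⌊⌋-true (outer k ≟P outer k) refl =
  ∨-zeroʳ ⌊ spine k ≟P outer k ⌋

pairOf-index : ∀ {v} s → (v ∈ᵇ pairOf (suc s)) ≡ true → pairIndex v ≡ s
pairOf-index {v} s v∈Pₛ rewrite pairOf-spine-outer s with spine s ≟P v | outer s ≟P v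
... | yes refl | _        = pairIndex-spine s
... | no _     | yes refl = pairIndex-outer s
... | no _     | no _     with () ← v∈Pₛ

labelAt-pairIndex : ∀ {n} (x : Vec ℕ (suc n)) s {v} → s ≤ pairIndex v → InOwnPair v →
  labelAt x (suc s) v ≡ lookupℕ x ((pairIndex v ∸ s) ⊓ n)
labelAt-pairIndex {zero}  (x ∷ [])     s {v} _ _ = cong (lookupℕ (x ∷ [])) (sym (⊓-zeroʳ (pairIndex v ∸ s)))
labelAt-pairIndex {suc n} (x ∷ y ∷ xs) s {v} s≤i own with v ∈ᵇ pairOf (suc s) in v∈Pₛ
... | true  = cong (λ d → lookupℕ (x ∷ y ∷ xs) (d ⊓ suc n))
                   (trans (sym (n∸n≡0 s)) (cong (_∸ s) (sym (pairOf-index s v∈Pₛ))))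
... | false = trans (labelAt-pairIndex (y ∷ xs) (suc s) s<i own)
                    (cong (λ d → lookupℕ (x ∷ y ∷ xs) (d ⊓ suc n)) (sym (+-∸-assoc 1 s<i)))
  where
  s<i : s < pairIndex v
  s<i = ≤∧≢⇒< s≤i (λ { refl → case trans (sym v∈Pₛ) own of λ () })

label-pairIndex : ∀ {n} (x : Vec ℕ (suc n)) {v} → InOwnPair v → label x v ≡ lookupℕ x (pairIndex v ⊓ n)
label-pairIndex x = labelAt-pairIndex x 0 z≤n

-- The vertices outside P_0, …, P_{N-1} form P_N, hence the index is capped at N.
snakeLabel : ℕ → (ℕ → ℕ) → Point → ℕ
snakeLabel N f v = f (pairIndex v ⊓ N)

snakeLabel-at : ∀ N f v {i} → pairIndex v ≡ i → snakeLabel N f v ≡ f (i ⊓ N)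
snakeLabel-at N f v = cong (λ i → f (i ⊓ N))

-- For N ≥ 1 these list the vertices and edges of G_N; for N = 0 they describe the single side
-- (spine 0 , spine 1) that T_1 is glued to.
snakeVertices : ℕ → List Point
snakeVertices zero    = spine 0 ∷ spine 1 ∷ []
snakeVertices (suc N) = snakeVertices N ++ newVertices N

snakeEdges : ℕ → List Edge
snakeEdges zero    = sharedSide 0 ∷ []
snakeEdges (suc N) = snakeEdges N ++ newEdges N

Bounded : Point → Edge → Set
Bounded B e = proj₁ e ≤P B × proj₂ e ≤P B

snakeVertices-bounded : ∀ N → All (_≤P spine (suc N)) (snakeVertices N)
snakeVertices-bounded zero    = (z≤n , z≤n) ∷ ≤P-refl ∷ []
snakeVertices-bounded (suc N) =
  All.++⁺ (All.map (λ p → ≤P-trans p (spine-≤P-suc (suc N))) (snakeVertices-bounded N))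
          (outer-≤P N ∷ ≤P-refl ∷ [])

snakeEdges-bounded : ∀ N → All (Bounded (spine (suc N))) (snakeEdges N)
snakeEdges-bounded zero    = ((z≤n , z≤n) , ≤P-refl) ∷ []
snakeEdges-bounded (suc N) = All.++⁺
  (All.map (λ (p , q) → ≤P-trans p b≤w , ≤P-trans q b≤w) (snakeEdges-bounded N))
  ((≤P-trans (spine-≤P-suc N) b≤w , outer-≤P N) ∷ (b≤w , ≤P-refl) ∷ (outer-≤P N , ≤P-refl) ∷ [])
  where
  b≤w = spine-≤P-suc (suc N)

∉-bounded : ∀ {B v vs} → All (_≤P B) vs → ¬ v ≤P B → v ∉ vs
∉-bounded vs≤B v≰B v∈vs = v≰B (All.lookup vs≤B v∈vs)

isolated-bounded : ∀ {B v es} → All (Bounded B) es → ¬ v ≤P B → All (λ e → incident v e ≡ false) es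
isolated-bounded es≤B v≰B = All.map (λ (p , q) → incident-≢ (λ eq → v≰B (subst (_≤P _) eq p))
                                                           (λ eq → v≰B (subst (_≤P _) eq q))) es≤B

module Tile (N : ℕ) where

  a≢b : spine N ≢ spine (suc N)
  a≢b = pairIndex-≢ (pairIndex-spine N) (pairIndex-spine (suc N)) (<⇒≢ ≤-refl)

  b≢u : spine (suc N) ≢ outer N
  b≢u eq = outer-≰P N (subst (_≤P spine (suc N)) eq ≤P-refl)

  a≢w : spine N ≢ spine (suc (suc N))
  a≢w eq = spine-≰P N (subst (_≤P spine (suc N)) eq (spine-≤P-suc N))

  u≢w : outer N ≢ spine (suc (suc N))
  u≢w = pairIndex-≢ (pairIndex-outer N) (pairIndex-spine (suc (suc N))) (<⇒≢ (m<n⇒m<1+n ≤-refl))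

newSides-unique : ∀ {a b u w} → a ≢ b → b ≢ u → u ≢ w → Unique (newSides a b u w)
newSides-unique a≢b b≢u u≢w =
  (a≢b ∘ cong proj₁ ∷ u≢w ∘ cong proj₂ ∷ []) ∷ (b≢u ∘ cong proj₁ ∷ []) ∷ [] ∷ []

snakeVertices-unique : ∀ N → Unique (snakeVertices N)
snakeVertices-unique zero    = ((λ ()) ∷ []) ∷ [] ∷ []
snakeVertices-unique (suc N) = Unique.++⁺ (snakeVertices-unique N) ((Tile.u≢w N ∷ []) ∷ [] ∷ [])
  λ where (v∈ , here refl)         → ∉-bounded (snakeVertices-bounded N) (outer-≰P N) v∈
          (v∈ , there (here refl)) → ∉-bounded (snakeVertices-bounded N) (spine-≰P N) v∈

snakeEdges-unique : ∀ N → Unique (snakeEdges N)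
snakeEdges-unique zero    = [] ∷ []
snakeEdges-unique (suc N) = Unique.++⁺ (snakeEdges-unique N) (newSides-unique a≢b b≢u u≢w)
  λ where (e∈ , here refl)                 → outer-≰P N (proj₂ (All.lookup (snakeEdges-bounded N) e∈))
          (e∈ , there (here refl))         → spine-≰P N (proj₂ (All.lookup (snakeEdges-bounded N) e∈))
          (e∈ , there (there (here refl))) → outer-≰P N (proj₁ (All.lookup (snakeEdges-bounded N) e∈))
  where open Tile N

snakeVertices-inOwnPair : ∀ N → All InOwnPair (snakeVertices N)
snakeVertices-inOwnPair zero    = InOwnPair-spine 0 ∷ InOwnPair-spine 1 ∷ []
snakeVertices-inOwnPair (suc N) =
  All.++⁺ (snakeVertices-inOwnPair N) (InOwnPair-outer N ∷ InOwnPair-spine (suc (suc N)) ∷ [])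

SnakeVertex : ℕ → Point → Set
SnakeVertex N v = pairIndex v < N ⊎ v ≡ spine N ⊎ v ≡ spine (suc N)

snakeVertices-shape : ∀ N → All (SnakeVertex N) (snakeVertices N)
snakeVertices-shape zero    = inj₂ (inj₁ refl) ∷ inj₂ (inj₂ refl) ∷ []
snakeVertices-shape (suc N) = All.++⁺ (All.map older (snakeVertices-shape N))
  (inj₁ (≤-reflexive (cong suc (pairIndex-outer N))) ∷ inj₂ (inj₂ refl) ∷ [])
  where
  older : ∀ {v} → SnakeVertex N v → SnakeVertex (suc N) v
  older (inj₁ i<N)         = inj₁ (m<n⇒m<1+n i<N)
  older (inj₂ (inj₁ refl)) = inj₁ (≤-reflexive (cong suc (pairIndex-spine N)))
  older (inj₂ (inj₂ refl)) = inj₂ (inj₁ refl)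

relabel-snakeLabel : ∀ N f g →
  All (λ v → relabel (spine N) (spine (suc N)) g (snakeLabel (suc N) f) v ≡ snakeLabel N (f [ N ↦ g ]) v)
      (snakeVertices N)
relabel-snakeLabel N f g = All.map relabel-shape (snakeVertices-shape N)
  where
  relabel-shape : ∀ {v} → SnakeVertex N v →
    relabel (spine N) (spine (suc N)) g (snakeLabel (suc N) f) v ≡ snakeLabel N (f [ N ↦ g ]) v
  relabel-shape {v} (inj₁ i<N) = begin
    relabel (spine N) (spine (suc N)) g (snakeLabel (suc N) f) v
      ≡⟨ relabel-≢ {spine N} {spine (suc N)} {v} g (snakeLabel (suc N) f)
                   (pairIndex-≢ (pairIndex-spine N) refl (<⇒≢ i<N ∘ sym))
                   (pairIndex-≢ (pairIndex-spine (suc N)) refl (<⇒≢ (m<n⇒m<1+n i<N) ∘ sym)) ⟩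
    f (pairIndex v ⊓ suc N)           ≡⟨ cong f (m≤n⇒m⊓n≡m (<⇒≤ (m<n⇒m<1+n i<N))) ⟩
    f (pairIndex v)                   ≡⟨ cong (if_then g else f (pairIndex v)) (≡ᵇ-false (<⇒≢ i<N)) ⟨
    (f [ N ↦ g ]) (pairIndex v)       ≡⟨ cong (f [ N ↦ g ]) (m≤n⇒m⊓n≡m (<⇒≤ i<N)) ⟨
    (f [ N ↦ g ]) (pairIndex v ⊓ N)   ∎
    where open ≡-Reasoning
  relabel-shape (inj₂ (inj₁ refl)) rewrite relabel-a (spine N) (spine (suc N)) g (snakeLabel (suc N) f)
                                         | pairIndex-spine N | ⊓-idem N | ≡ᵇ-refl N = refl
  relabel-shape (inj₂ (inj₂ refl)) rewrite relabel-b (spine N) (spine (suc N)) g (snakeLabel (suc N) f)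
                                         | pairIndex-spine (suc N) | m≥n⇒m⊓n≡n (n≤1+n N) | ≡ᵇ-refl N = refl

snake-glue : ∀ N f →
  Covers′ (snakeEdges (suc N)) (snakeVertices (suc N)) (snakeLabel (suc N) f) ↔
  Σ ℕ (λ g → (g ≤ f N × g ≤ f (suc N)) ×
             Covers′ (snakeEdges N) (snakeVertices N) (relabel (spine N) (spine (suc N)) g (snakeLabel (suc N) f)))
snake-glue N f = Gluing.Covers′-glue a≢b b≢u a≢w u≢w
  (∉-bounded (snakeVertices-bounded N) (outer-≰P N)) (∉-bounded (snakeVertices-bounded N) (spine-≰P N))
  (isolated-bounded (snakeEdges-bounded N) (outer-≰P N)) (isolated-bounded (snakeEdges-bounded N) (spine-≰P N))
  (trans (snakeLabel-at (suc N) f (spine N) (pairIndex-spine N)) (cong f (m≤n⇒m⊓n≡m (n≤1+n N))))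
  (trans (snakeLabel-at (suc N) f (spine (suc N)) (pairIndex-spine (suc N))) (cong f (⊓-idem (suc N))))
  (trans (snakeLabel-at (suc N) f (outer N) (pairIndex-outer N)) (cong f (m≤n⇒m⊓n≡m (n≤1+n N))))
  (trans (snakeLabel-at (suc N) f (spine (suc (suc N))) (pairIndex-spine (suc (suc N))))
         (cong f (m≥n⇒m⊓n≡n (n≤1+n (suc N)))))
  where open Tile N

single-edge-covers : ∀ f → Covers′ (snakeEdges 0) (snakeVertices 0) (snakeLabel 0 f) ↔ Fin 1
single-edge-covers f = mk↔ₛ′ (λ _ → zero) (λ _ → f 0 ∷ [] , f0+0 ∷ f0+0 ∷ []) (λ { zero → refl })
  (λ { (x ∷ [] , x+0≡f0 ∷ _) →
         Σ-≡,≡→≡ (cong (_∷ []) (trans (sym x+0≡f0) (+-identityʳ x)) , All-≡-irrelevant _ _) })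
  where
  f0+0 = +-identityʳ (f 0)

snake-covers : ∀ N f → Covers′ (snakeEdges N) (snakeVertices N) (snakeLabel N f) ↔ Fin (chains 0 f N)
snake-covers zero    f = single-edge-covers f
snake-covers (suc N) f = begin
  Covers′ (snakeEdges (suc N)) (snakeVertices (suc N)) (snakeLabel (suc N) f)
    ↔⟨ snake-glue N f ⟩
  Σ ℕ (λ g → (g ≤ f N × g ≤ f (suc N)) ×
             Covers′ (snakeEdges N) (snakeVertices N) (relabel (spine N) (spine (suc N)) g (snakeLabel (suc N) f)))
    ↔⟨ Σ-↔ ↔-refl (↔-refl ×-↔ ↔-trans (Covers′-cong {snakeEdges N} (relabel-snakeLabel N f _))
                                      (snake-covers N _)) ⟩
  Σ ℕ (λ g → (g ≤ f N × g ≤ f (suc N)) × Fin (chains 0 (f [ N ↦ g ]) N))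
    ↔⟨ Fin-chains-suc N f ⟨
  Fin (chains 0 f (suc N)) ∎
  where open Related.EquationalReasoning

edges-↭ : ∀ N → edges (suc N) ↭ snakeEdges (suc N)
edges-↭ N = Tiling.deduplicate-tiles-↭ sides (λ k → sharedSide k ∷ []) newEdges snakeEdges
  refl (λ _ → refl) sides-spine (λ { _ (here refl) → there (there (here refl)) })
  _≟E_ N (snakeEdges-unique (suc N))

vertices-↭ : ∀ N → vertices (suc N) ↭ snakeVertices (suc N)
vertices-↭ N = Tiling.deduplicate-tiles-↭ corners (λ k → spine k ∷ spine (suc k) ∷ []) newVertices snakeVertices
  refl (λ _ → refl) corners-spine
  (λ { _ (here refl) → there (here refl) ; _ (there (here refl)) → there (there (there (here refl))) })
  _≟P_ N (snakeVertices-unique (suc N))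

Covers-snake : ∀ N (x : Vec ℕ (suc (suc N))) →
  Covers (suc N) x ↔ Covers′ (snakeEdges (suc N)) (snakeVertices (suc N)) (snakeLabel (suc N) (lookupℕ x))
Covers-snake N x = ↔-trans (Covers′-resp-↭ (edges-↭ N) (vertices-↭ N))
  (Covers′-cong {snakeEdges (suc N)} (All.map (label-pairIndex x) (snakeVertices-inOwnPair (suc N))))

[last]≔lastV : ∀ {n} (v : Vec ℕ (suc n)) → v [ fromℕ n ]≔ lastV v ≡ v
[last]≔lastV (x ∷ [])     = refl
[last]≔lastV (x ∷ y ∷ ys) = cong (x ∷_) ([last]≔lastV (y ∷ ys))

theorem6 : ∀ (k : ℕ) (m : Vec ℕ (suc (suc k)))
    → ((i : Fin (suc (headV m))) (j : Fin (suc (lastV m)))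
        → Fin (X m i j) ↔ Covers (suc k) ((m [ zero ]≔ (headV m ∸ toℕ i)) [ fromℕ (suc k) ]≔ (lastV m ∸ toℕ j)))
      × (Fin (X m zero zero) ↔ Covers (suc k) m)
theorem6 k m@(_ ∷ _) =
  entry , subst (λ m′ → Fin (X m zero zero) ↔ Covers (suc k) m′) ([last]≔lastV m) (entry zero zero)
  where
  entry : (i : Fin (suc (headV m))) (j : Fin (suc (lastV m))) →
    Fin (X m i j) ↔ Covers (suc k) ((m [ zero ]≔ (headV m ∸ toℕ i)) [ fromℕ (suc k) ]≔ (lastV m ∸ toℕ j))
  entry i j = begin
    Fin (X m i j)                        ≡⟨ cong Fin (X-entry k m i j) ⟩
    Fin (chains 0 (lookupℕ m′) (suc k))  ↔⟨ snake-covers (suc k) (lookupℕ m′) ⟨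
    Covers′ (snakeEdges (suc k)) (snakeVertices (suc k)) (snakeLabel (suc k) (lookupℕ m′))
                                         ↔⟨ Covers-snake k m′ ⟨
    Covers (suc k) m′                    ∎
    where
    open Related.EquationalReasoning
    m′ = (m [ zero ]≔ (headV m ∸ toℕ i)) [ fromℕ (suc k) ]≔ (lastV m ∸ toℕ j)
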